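{- Let $\beta,\gamma$ be non-negative integers with $(\beta,\gamma)\neq(0,0)$, and let $H_n(\beta,\gamma)$ denote the coefficient of $\frac{x^n}{n!}$ in $\frac{e^{\gamma x}}{2-e^{\beta x}}$. Then for every $n\in\mathbb{N}_0$, $H_n(\beta,\gamma)$ equals the number of barred preferential arrangements of $X_n=\{1,\dots,n\}$ with exactly one bar, in which the first (left) section has the property that its elements are distributed into $\gamma$ labelled compartments (i.e. each element of that section is given a label from $\{1,\dots,\gamma\}$; the section may be empty), and the second (right) section is a preferential arrangement (ordered sequence of non-empty blocks, possibly no blocks) in which the elements of each block are distributed into $\beta$ labelled compartments (i.e. each element of the section is given a label from $\{1,\dots,\beta\}$).
   Context: A preferential arrangement of a finite set is an ordered set partition (a sequence of non-empty disjoint blocks whose union is the set). A barred preferential arrangement of $X_n$ with $\xi$ bars is obtained by placing $\xi$ identical bars, creating $\xi+1$ ordered sections, and distributing the elements of $X_n$ among the sections, each section carrying a (possibly empty) preferential arrangement of its elements. Convention $0^0=1$. -}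

module Defs where

open import Data.Nat as ℕ using (ℕ; zero; suc; _∸_)
open import Data.Nat.Combinatorics using (_C_)
open import Data.Integer using (+_)
open import Data.Rational using (ℚ; _/_; _+_; _*_; _-_; 0ℚ)
open import Data.Bool using (Bool; true; false; T; _∧_; _∨_)
open import Data.Fin using (Fin; _≟_)
open import Data.Fin as Fin using ()
open import Data.Sum using (_⊎_; inj₁; inj₂)
open import Data.Product using (Σ; _×_; _,_; proj₁)
open import Data.Vec using (Vec)
open import Data.Vec as Vec using ()
open import Data.List using (List)
open import Data.List as List using ()
open import Relation.Nullary.Decidable using (⌊_⌋)

ℕ→ℚ : ℕ → ℚ
ℕ→ℚ n = + n / 1

-- Formal power series in exponential normalisation:
-- a series is represented by s : ℕ → ℚ, where s n is the coefficient
-- of x^n / n!.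

EGF : Set
EGF = ℕ → ℚ

sumTo : ℕ → (ℕ → ℚ) → ℚ
sumTo zero    f = f zero
sumTo (suc n) f = sumTo n f + f (suc n)

-- product of power series, in exponential normalisation
-- (binomial convolution): (f·g)_n = Σ_k C(n,k) f_k g_{n-k}
egfMul : EGF → EGF → EGF
egfMul f g n = sumTo n (λ k → ℕ→ℚ (n C k) * (f k * g (n ∸ k)))

-- e^{c x} : coefficient of x^n/n! is c^n
expS : ℕ → EGF
expS c n = ℕ→ℚ (c ℕ.^ n)

constS : ℕ → EGF
constS a zero    = ℕ→ℚ a
constS a (suc n) = 0ℚ

twoMinusExp : ℕ → EGF
twoMinusExp β n = constS 2 n - expS β n

-- Barred preferential arrangements of X_n = Fin n with one bar, where
-- each element of the left section receives a label in Fin γ, and the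
-- right section carries a preferential arrangement into k ordered
-- non-empty blocks (block j : Fin k) with each element labelled in Fin β.
--
-- An element is sent to  inj₁ c        (left section, compartment c)
--                   or   inj₂ (j , b)  (right section, block j, compartment b).

Assignment : ℕ → ℕ → ℕ → ℕ → Set
Assignment β γ k n = Vec (Fin γ ⊎ (Fin k × Fin β)) n

inBlock : ∀ {β γ k} → Fin k → Fin γ ⊎ (Fin k × Fin β) → Bool
inBlock j (inj₁ _)       = false
inBlock j (inj₂ (j' , _)) = ⌊ j ≟ j' ⌋

-- every block of the right section is non-empty (boolean, so that the
-- proof of T (blocksNonEmpty v) is unique)
blocksNonEmpty : ∀ {β γ k n} → Assignment β γ k n → Bool
blocksNonEmpty {k = k} v =
  List.foldr (λ j r → Vec.foldr _ (λ x r' → inBlock j x ∨ r') false v ∧ r) true (List.allFin k)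

Arr : (β γ n : ℕ) → Set
Arr β γ n = Σ ℕ λ k → Σ (Assignment β γ k n) λ v → T (blocksNonEmpty v)

-- Expanding the binomial convolution, the equation defining H says that H₀ = 1 and
-- H_{n+1} = γ^{n+1} + Σ_{k=0}^{n} C(n+1, k+1) β^{k+1} H_{n-k}.  The arrangements satisfy the
-- same recurrence: either the right section has no blocks, leaving γ^n labellings of the left
-- section, or its first block consists of some a ≥ 1 elements (C(n, a) choices, β^a labellings)
-- and the other n - a elements form an arrangement of the same kind.

module Submission where

open import Defs
open import Algebra.Properties.CommutativeSemigroup using (interchange; x∙yz≈y∙xz)
open import Data.Bool using (Bool; true; false; T; _∧_; _∨_)
open import Data.Bool.Properties using (T-irrelevant; T-∧)
open import Data.Fin using (Fin; zero; suc; _≟_)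
open import Data.Fin.Properties using (+↔⊎; *↔×; cantor-schröder-bernstein; suc-injective)
import Data.Integer as ℤ
import Data.Integer.Properties as ℤ
open import Data.List as List using ()
open import Data.Nat using (ℕ; zero; suc; _+_; _*_; _∸_; _^_; _<_; _≤_; _<ᵇ_; z≤n; s≤s)
open import Data.Nat.Combinatorics using (_C_; nCk+nC[k+1]≡[n+1]C[k+1]; k>n⇒nCk≡0)
open import Data.Nat.Coprimality using (1-coprimeTo) renaming (sym to coprime-sym)
open import Data.Nat.Induction using (<-rec)
open import Data.Nat.Properties
  using (+-assoc; +-suc; +-identityʳ; *-zeroʳ; *-distribʳ-+; +-∸-assoc; m∸n≤m; m≤n+m;
         m≤n⇒m≤1+n; n<1+n; ≤-refl; +-commutativeSemigroup)
open import Data.Product using (Σ; _×_; _,_; proj₁; proj₂)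
open import Data.Product.Function.Dependent.Propositional using (Σ-↔)
open import Data.Product.Function.NonDependent.Propositional using (_×-↔_)
open import Data.Rational as ℚ using (ℚ; toℚᵘ; -_; 0ℚ)
open import Data.Rational.Properties as ℚ
  using (normalize-coprime; toℚᵘ-injective; toℚᵘ-homo-+; toℚᵘ-homo-*; neg-distrib-+)
open import Data.Rational.Solver using (module +-*-Solver)
import Data.Rational.Unnormalised as ℚᵘ
import Data.Rational.Unnormalised.Properties as ℚᵘ
open import Data.Sum using (_⊎_; inj₁; inj₂)
open import Data.Sum.Function.Propositional using (_⊎-↔_)
open import Data.Unit using (tt)
open import Data.Vec as Vec using (Vec; []; _∷_)
open import Data.Vec.Properties using (map-∘; map-cong; map-id)
open import Function using (_∘_)
open import Function.Bundles using (_↔_; mk↔ₛ′; Inverse; Injection; Equivalence)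
open import Function.Properties.Inverse using (↔-refl; ↔-sym; ↔-trans; ↔⇒↣)
open import Function.Related.Propositional using (K-reflexive)
open import Relation.Binary.PropositionalEquality
open import Relation.Nullary using (¬_)
open import Relation.Nullary.Decidable using (⌊⌋-map′)

private
  variable
    A B : Set
    k m n : ℕ

sumToℕ : ℕ → (ℕ → ℕ) → ℕ
sumToℕ zero    f = f zero
sumToℕ (suc n) f = sumToℕ n f + f (suc n)

sumToℕ-cong : ∀ n {f g : ℕ → ℕ} → (∀ k → k ≤ n → f k ≡ g k) → sumToℕ n f ≡ sumToℕ n g
sumToℕ-cong zero    f≡g = f≡g 0 z≤n
sumToℕ-cong (suc n) f≡g =
  cong₂ _+_ (sumToℕ-cong n (λ k k≤n → f≡g k (m≤n⇒m≤1+n k≤n))) (f≡g (suc n) ≤-refl)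

sumToℕ-suc : ∀ n (f : ℕ → ℕ) → sumToℕ (suc n) f ≡ f 0 + sumToℕ n (f ∘ suc)
sumToℕ-suc zero    f = refl
sumToℕ-suc (suc n) f = begin
  sumToℕ (suc n) f + f (suc (suc n))            ≡⟨ cong (_+ f (suc (suc n))) (sumToℕ-suc n f) ⟩
  f 0 + sumToℕ n (f ∘ suc) + f (suc (suc n))    ≡⟨ +-assoc (f 0) _ _ ⟩
  f 0 + sumToℕ (suc n) (f ∘ suc)                ∎
  where open ≡-Reasoning

sumToℕ-+ : ∀ n (f g : ℕ → ℕ) → sumToℕ n (λ k → f k + g k) ≡ sumToℕ n f + sumToℕ n g
sumToℕ-+ zero    f g = refl
sumToℕ-+ (suc n) f g =
  trans (cong (_+ (f (suc n) + g (suc n))) (sumToℕ-+ n f g))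
        (interchange +-commutativeSemigroup (sumToℕ n f) (sumToℕ n g) (f (suc n)) (g (suc n)))

toℚᵘ-ℕ→ℚ : ∀ n → toℚᵘ (ℕ→ℚ n) ≡ ℚᵘ.mkℚᵘ (ℤ.+ n) 0
toℚᵘ-ℕ→ℚ n = cong toℚᵘ (normalize-coprime (coprime-sym (1-coprimeTo n)))

ℕ→ℚ-+ : ∀ a b → ℕ→ℚ (a + b) ≡ ℕ→ℚ a ℚ.+ ℕ→ℚ b
ℕ→ℚ-+ a b = toℚᵘ-injective (begin
  toℚᵘ (ℕ→ℚ (a + b))                         ≡⟨ toℚᵘ-ℕ→ℚ (a + b) ⟩
  ℚᵘ.mkℚᵘ (ℤ.+ (a + b)) 0                    ≡⟨ cong (λ z → ℚᵘ.mkℚᵘ z 0) numerator ⟩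
  ℚᵘ.mkℚᵘ (ℤ.+ a) 0 ℚᵘ.+ ℚᵘ.mkℚᵘ (ℤ.+ b) 0   ≡⟨ cong₂ ℚᵘ._+_ (toℚᵘ-ℕ→ℚ a) (toℚᵘ-ℕ→ℚ b) ⟨
  toℚᵘ (ℕ→ℚ a) ℚᵘ.+ toℚᵘ (ℕ→ℚ b)             ≈⟨ toℚᵘ-homo-+ (ℕ→ℚ a) (ℕ→ℚ b) ⟨
  toℚᵘ (ℕ→ℚ a ℚ.+ ℕ→ℚ b)                     ∎)
  where
  open ℚᵘ.≃-Reasoning
  numerator : ℤ.+ (a + b) ≡ (ℤ.+ a) ℤ.* ℤ.1ℤ ℤ.+ (ℤ.+ b) ℤ.* ℤ.1ℤ
  numerator = trans (ℤ.pos-+ a b)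
                    (sym (cong₂ ℤ._+_ (ℤ.*-identityʳ (ℤ.+ a)) (ℤ.*-identityʳ (ℤ.+ b))))

ℕ→ℚ-* : ∀ a b → ℕ→ℚ (a * b) ≡ ℕ→ℚ a ℚ.* ℕ→ℚ b
ℕ→ℚ-* a b = toℚᵘ-injective (begin
  toℚᵘ (ℕ→ℚ (a * b))                         ≡⟨ toℚᵘ-ℕ→ℚ (a * b) ⟩
  ℚᵘ.mkℚᵘ (ℤ.+ (a * b)) 0                    ≡⟨ cong (λ z → ℚᵘ.mkℚᵘ z 0) (ℤ.pos-* a b) ⟩
  ℚᵘ.mkℚᵘ (ℤ.+ a) 0 ℚᵘ.* ℚᵘ.mkℚᵘ (ℤ.+ b) 0   ≡⟨ cong₂ ℚᵘ._*_ (toℚᵘ-ℕ→ℚ a) (toℚᵘ-ℕ→ℚ b) ⟨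
  toℚᵘ (ℕ→ℚ a) ℚᵘ.* toℚᵘ (ℕ→ℚ b)             ≈⟨ toℚᵘ-homo-* (ℕ→ℚ a) (ℕ→ℚ b) ⟨
  toℚᵘ (ℕ→ℚ a ℚ.* ℕ→ℚ b)                     ∎)
  where open ℚᵘ.≃-Reasoning

sumTo-cong : ∀ n {f g : ℕ → ℚ} → (∀ k → k ≤ n → f k ≡ g k) → sumTo n f ≡ sumTo n g
sumTo-cong zero    f≡g = f≡g 0 z≤n
sumTo-cong (suc n) f≡g =
  cong₂ ℚ._+_ (sumTo-cong n (λ k k≤n → f≡g k (m≤n⇒m≤1+n k≤n))) (f≡g (suc n) ≤-refl)

sumTo-suc : ∀ n (f : ℕ → ℚ) → sumTo (suc n) f ≡ f 0 ℚ.+ sumTo n (f ∘ suc)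
sumTo-suc zero    f = refl
sumTo-suc (suc n) f = begin
  sumTo (suc n) f ℚ.+ f (suc (suc n))              ≡⟨ cong (ℚ._+ f (suc (suc n))) (sumTo-suc n f) ⟩
  f 0 ℚ.+ sumTo n (f ∘ suc) ℚ.+ f (suc (suc n))    ≡⟨ ℚ.+-assoc (f 0) _ _ ⟩
  f 0 ℚ.+ sumTo (suc n) (f ∘ suc)                  ∎
  where open ≡-Reasoning

sumTo-neg : ∀ n (f : ℕ → ℚ) → sumTo n (λ k → - f k) ≡ - sumTo n f
sumTo-neg zero    f = refl
sumTo-neg (suc n) f =
  trans (cong (ℚ._+ - f (suc n)) (sumTo-neg n f)) (sym (neg-distrib-+ (sumTo n f) (f (suc n))))

ℕ→ℚ-sumTo : ∀ n (f : ℕ → ℕ) → ℕ→ℚ (sumToℕ n f) ≡ sumTo n (ℕ→ℚ ∘ f)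
ℕ→ℚ-sumTo zero    f = refl
ℕ→ℚ-sumTo (suc n) f =
  trans (ℕ→ℚ-+ (sumToℕ n f) (f (suc n))) (cong (ℚ._+ ℕ→ℚ (f (suc n))) (ℕ→ℚ-sumTo n f))

data Shuffle : ℕ → ℕ → ℕ → Set where
  []    : Shuffle 0 0 0
  left  : ∀ {a b n} → Shuffle a b n → Shuffle (suc a) b (suc n)
  right : ∀ {a b n} → Shuffle a b n → Shuffle a (suc b) (suc n)

Shuffled : ℕ → (ℕ → ℕ → Set) → Set
Shuffled n P = Σ ℕ λ a → Σ ℕ λ b → Shuffle a b n × P a b

Shuffled-zero : ∀ P → Shuffled 0 P ↔ P 0 0
Shuffled-zero P = mk↔ₛ′ (λ { (_ , _ , [] , x) → x }) (λ x → 0 , 0 , [] , x)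
  (λ _ → refl) (λ { (_ , _ , [] , x) → refl })

Shuffled-suc : ∀ n P → Shuffled (suc n) P ↔
               (Shuffled n (λ a b → P (suc a) b) ⊎ Shuffled n (λ a b → P a (suc b)))
Shuffled-suc n P = mk↔ₛ′ to from to∘from from∘to
  where
  to : Shuffled (suc n) P → Shuffled n (λ a b → P (suc a) b) ⊎ Shuffled n (λ a b → P a (suc b))
  to (_ , b , left s  , x) = inj₁ (_ , b , s , x)
  to (a , _ , right s , x) = inj₂ (a , _ , s , x)
  from : Shuffled n (λ a b → P (suc a) b) ⊎ Shuffled n (λ a b → P a (suc b)) → Shuffled (suc n) P
  from (inj₁ (a , b , s , x)) = suc a , b , left s , x
  from (inj₂ (a , b , s , x)) = a , suc b , right s , x
  to∘from : ∀ y → to (from y) ≡ y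
  to∘from (inj₁ _) = refl
  to∘from (inj₂ _) = refl
  from∘to : ∀ x → from (to x) ≡ x
  from∘to (_ , _ , left s  , _) = refl
  from∘to (_ , _ , right s , _) = refl

shuffleCount : ℕ → (ℕ → ℕ → ℕ) → ℕ
shuffleCount zero    p = p 0 0
shuffleCount (suc n) p = shuffleCount n (λ a b → p (suc a) b) + shuffleCount n (λ a b → p a (suc b))

Shuffled↔Fin : ∀ n (P : ℕ → ℕ → Set) (p : ℕ → ℕ → ℕ) →
               (∀ a b → a + b ≡ n → P a b ↔ Fin (p a b)) → Shuffled n P ↔ Fin (shuffleCount n p)
Shuffled↔Fin zero    P p P↔p = ↔-trans (Shuffled-zero P) (P↔p 0 0 refl)
Shuffled↔Fin (suc n) P p P↔p = ↔-trans (Shuffled-suc n P) (↔-trans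
  (Shuffled↔Fin n _ _ (λ a b a+b≡n → P↔p (suc a) b (cong suc a+b≡n)) ⊎-↔
   Shuffled↔Fin n _ _ (λ a b a+b≡n → P↔p a (suc b) (trans (+-suc a b) (cong suc a+b≡n))))
  (↔-sym +↔⊎))

shuffleCount-binomial : ∀ n p → shuffleCount n p ≡ sumToℕ n (λ a → (n C a) * p a (n ∸ a))
shuffleCount-binomial zero    p = sym (+-identityʳ (p 0 0))
shuffleCount-binomial (suc n) p = begin
  shuffleCount n (λ a b → p (suc a) b) + shuffleCount n (λ a b → p a (suc b))
    ≡⟨ cong₂ _+_ (shuffleCount-binomial n _) (shuffleCount-binomial n _) ⟩
  sumToℕ n lefts + sumToℕ n rights
    ≡⟨ cong (sumToℕ n lefts +_) rights-shifted ⟩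
  sumToℕ n lefts + (term 0 + sumToℕ n (term ∘ suc))
    ≡⟨ x∙yz≈y∙xz +-commutativeSemigroup (sumToℕ n lefts) (term 0) _ ⟩
  term 0 + (sumToℕ n lefts + sumToℕ n (term ∘ suc))
    ≡⟨ cong (term 0 +_) (sumToℕ-+ n lefts (term ∘ suc)) ⟨
  term 0 + sumToℕ n (λ k → lefts k + term (suc k))
    ≡⟨ cong (term 0 +_) (sumToℕ-cong n (λ k _ → pascal k)) ⟩
  term 0 + sumToℕ n (λ k → (suc n C suc k) * p (suc k) (n ∸ k))
    ≡⟨ sumToℕ-suc n (λ a → (suc n C a) * p a (suc n ∸ a)) ⟨
  sumToℕ (suc n) (λ a → (suc n C a) * p a (suc n ∸ a)) ∎
  where
  open ≡-Reasoning
  lefts rights term : ℕ → ℕ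
  lefts  a = (n C a) * p (suc a) (n ∸ a)
  rights a = (n C a) * p a (suc (n ∸ a))
  term   a = (n C a) * p a (suc n ∸ a)
  pascal : ∀ k → lefts k + term (suc k) ≡ (suc n C suc k) * p (suc k) (n ∸ k)
  pascal k = trans (sym (*-distribʳ-+ (p (suc k) (n ∸ k)) (n C k) (n C suc k)))
                   (cong (_* p (suc k) (n ∸ k)) (nCk+nC[k+1]≡[n+1]C[k+1] n k))
  rights-shifted : sumToℕ n rights ≡ term 0 + sumToℕ n (term ∘ suc)
  rights-shifted = begin
    sumToℕ n rights       ≡⟨ sumToℕ-cong n (λ a a≤n → cong (λ z → (n C a) * p a z) (+-∸-assoc 1 a≤n)) ⟨
    sumToℕ n term         ≡⟨ +-identityʳ _ ⟨
    sumToℕ n term + 0     ≡⟨ cong (λ c → sumToℕ n term + c * p (suc n) (n ∸ n)) (k>n⇒nCk≡0 (n<1+n n)) ⟨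
    sumToℕ (suc n) term   ≡⟨ sumToℕ-suc n term ⟩
    term 0 + sumToℕ n (term ∘ suc) ∎

module _ {X Y : Set} where

  Vecs : ℕ → ℕ → Set
  Vecs a b = Vec X a × Vec Y b

  merge : ∀ {a b n} → Shuffle a b n → Vec X a → Vec Y b → Vec (X ⊎ Y) n
  merge []        []       []       = []
  merge (left s)  (x ∷ xs) ys       = inj₁ x ∷ merge s xs ys
  merge (right s) xs       (y ∷ ys) = inj₂ y ∷ merge s xs ys

  mergeShuffled : Shuffled n Vecs → Vec (X ⊎ Y) n
  mergeShuffled (_ , _ , s , xs , ys) = merge s xs ys

  unmerge : Vec (X ⊎ Y) n → Shuffled n Vecs
  unmerge []           = 0 , 0 , [] , [] , []
  unmerge (inj₁ x ∷ v) = let a , b , s , xs , ys = unmerge v in suc a , b , left s , x ∷ xs , ys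
  unmerge (inj₂ y ∷ v) = let a , b , s , xs , ys = unmerge v in a , suc b , right s , xs , y ∷ ys

  unmerge-merge : ∀ {a b n} (s : Shuffle a b n) xs ys → unmerge (merge s xs ys) ≡ (a , b , s , xs , ys)
  unmerge-merge []        []       []       = refl
  unmerge-merge (left s)  (x ∷ xs) ys       rewrite unmerge-merge s xs ys = refl
  unmerge-merge (right s) xs       (y ∷ ys) rewrite unmerge-merge s xs ys = refl

  merge-unmerge : (v : Vec (X ⊎ Y) n) → mergeShuffled (unmerge v) ≡ v
  merge-unmerge []           = refl
  merge-unmerge (inj₁ x ∷ v) = cong (inj₁ x ∷_) (merge-unmerge v)
  merge-unmerge (inj₂ y ∷ v) = cong (inj₂ y ∷_) (merge-unmerge v)

  Vec-⊎↔Shuffled : Vec (X ⊎ Y) n ↔ Shuffled n Vecs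
  Vec-⊎↔Shuffled = mk↔ₛ′ unmerge mergeShuffled
    (λ (_ , _ , s , xs , ys) → unmerge-merge s xs ys) merge-unmerge

Vec-map-↔ : A ↔ B → Vec A n ↔ Vec B n
Vec-map-↔ A↔B = mk↔ₛ′ (Vec.map to) (Vec.map from)
  (λ v → trans (sym (map-∘ to from v)) (trans (map-cong strictlyInverseˡ v) (map-id v)))
  (λ v → trans (sym (map-∘ from to v)) (trans (map-cong strictlyInverseʳ v) (map-id v)))
  where open Inverse A↔B

Vec-Fin↔Fin^ : ∀ k n → Vec (Fin k) n ↔ Fin (k ^ n)
Vec-Fin↔Fin^ k zero    = mk↔ₛ′ (λ _ → zero) (λ _ → []) (λ { zero → refl }) (λ { [] → refl })
Vec-Fin↔Fin^ k (suc n) = ↔-trans uncons (↔-trans (↔-refl ×-↔ Vec-Fin↔Fin^ k n) (↔-sym *↔×))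
  where
  uncons : Vec (Fin k) (suc n) ↔ (Fin k × Vec (Fin k) n)
  uncons = mk↔ₛ′ (λ { (x ∷ xs) → x , xs }) (λ (x , xs) → x ∷ xs) (λ _ → refl) (λ { (x ∷ xs) → refl })

Fin-injective : Fin m ↔ Fin n → m ≡ n
Fin-injective m↔n =
  cantor-schröder-bernstein (Injection.injective (↔⇒↣ m↔n)) (Injection.injective (↔⇒↣ (↔-sym m↔n)))

Σℕ↔⊎ : (F : ℕ → Set) → Σ ℕ F ↔ (F 0 ⊎ Σ ℕ (F ∘ suc))
Σℕ↔⊎ F = mk↔ₛ′ to from
  (λ { (inj₁ _) → refl ; (inj₂ _) → refl }) (λ { (zero , _) → refl ; (suc _ , _) → refl })
  where
  to : Σ ℕ F → F 0 ⊎ Σ ℕ (F ∘ suc)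
  to (zero  , x) = inj₁ x
  to (suc k , x) = inj₂ (k , x)
  from : F 0 ⊎ Σ ℕ (F ∘ suc) → Σ ℕ F
  from (inj₁ x)       = 0 , x
  from (inj₂ (k , x)) = suc k , x

Σ-T-↔ : (A↔B : A ↔ B) {f : A → Bool} {g : B → Bool} →
        (∀ y → f (Inverse.from A↔B y) ≡ g y) → Σ A (T ∘ f) ↔ Σ B (T ∘ g)
Σ-T-↔ A↔B {f} f∘from≡g = Σ-↔ A↔B (λ {x} → K-reflexive (cong T
  (trans (cong f (sym (strictlyInverseʳ x))) (f∘from≡g (to x)))))
  where open Inverse A↔B

Σ-Shuffled-comm : ∀ n (Q : ℕ → Set) (R : ℕ → ℕ → Set) →
  Σ ℕ (λ k → Shuffled n (λ a b → Q a × R k b)) ↔ Shuffled n (λ a b → Q a × Σ ℕ λ k → R k b)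
Σ-Shuffled-comm n Q R = mk↔ₛ′
  (λ (k , a , b , s , q , r) → a , b , s , q , k , r)
  (λ (a , b , s , q , k , r) → k , a , b , s , q , r)
  (λ _ → refl) (λ _ → refl)

foldr-∧-tabulate-cong : ∀ k {f : Fin k → A} {g : Fin k → B} {h₁ : A → Bool} {h₂ : B → Bool} →
  (∀ i → h₁ (f i) ≡ h₂ (g i)) →
  List.foldr (λ x r → h₁ x ∧ r) true (List.tabulate f) ≡ List.foldr (λ y r → h₂ y ∧ r) true (List.tabulate g)
foldr-∧-tabulate-cong zero    eq = refl
foldr-∧-tabulate-cong (suc k) eq = cong₂ _∧_ (eq zero) (foldr-∧-tabulate-cong k (eq ∘ suc))

module _ (β γ : ℕ) where

  Label : ℕ → Set
  Label k = Fin γ ⊎ (Fin k × Fin β)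

  Label-zero↔ : Label 0 ↔ Fin γ
  Label-zero↔ = mk↔ₛ′ (λ { (inj₁ c) → c ; (inj₂ (() , _)) }) inj₁
    (λ _ → refl) (λ { (inj₁ c) → refl ; (inj₂ (() , _)) })

  Label-suc↔ : Label (suc k) ↔ (Fin β ⊎ Label k)
  Label-suc↔ = mk↔ₛ′ to from to∘from from∘to
    where
    to : Label (suc k) → Fin β ⊎ Label k
    to (inj₁ c)            = inj₂ (inj₁ c)
    to (inj₂ (zero  , b)) = inj₁ b
    to (inj₂ (suc j , b)) = inj₂ (inj₂ (j , b))
    from : Fin β ⊎ Label k → Label (suc k)
    from (inj₁ b)                = inj₂ (zero , b)
    from (inj₂ (inj₁ c))         = inj₁ c
    from (inj₂ (inj₂ (j , b)))   = inj₂ (suc j , b)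
    to∘from : ∀ y → to (from y) ≡ y
    to∘from (inj₁ b)              = refl
    to∘from (inj₂ (inj₁ c))       = refl
    to∘from (inj₂ (inj₂ (j , b))) = refl
    from∘to : ∀ x → from (to x) ≡ x
    from∘to (inj₁ c)            = refl
    from∘to (inj₂ (zero  , b)) = refl
    from∘to (inj₂ (suc j , b)) = refl

  relabel : Fin β ⊎ Label k → Label (suc k)
  relabel = Inverse.from Label-suc↔

  occurs : Fin k → Vec (Label k) n → Bool
  occurs j v = Vec.foldr _ (λ x r → inBlock j x ∨ r) false v

  occurs-zero : ∀ {a b} (s : Shuffle a b n) xs (ys : Vec (Label k) b) →
                occurs zero (Vec.map relabel (merge s xs ys)) ≡ (0 <ᵇ a)
  occurs-zero []        []       []                  = refl
  occurs-zero (left s)  (x ∷ xs) ys                  = refl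
  occurs-zero (right s) xs       (inj₁ _ ∷ ys)       = occurs-zero s xs ys
  occurs-zero (right s) xs       (inj₂ (_ , _) ∷ ys) = occurs-zero s xs ys

  inBlock-relabel : (j : Fin k) (y : Label k) → inBlock (suc j) (relabel (inj₂ y)) ≡ inBlock j y
  inBlock-relabel j (inj₁ _)        = refl
  inBlock-relabel j (inj₂ (j′ , _)) = ⌊⌋-map′ (cong suc) suc-injective (j ≟ j′)

  occurs-suc : ∀ {a b} (j : Fin k) (s : Shuffle a b n) xs (ys : Vec (Label k) b) →
               occurs (suc j) (Vec.map relabel (merge s xs ys)) ≡ occurs j ys
  occurs-suc j []        []       []       = refl
  occurs-suc j (left s)  (x ∷ xs) ys       = occurs-suc j s xs ys
  occurs-suc j (right s) xs       (y ∷ ys) = cong₂ _∨_ (inBlock-relabel j y) (occurs-suc j s xs ys)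

  blocksNonEmpty-merge : ∀ {a b} (s : Shuffle a b n) xs (ys : Vec (Label k) b) →
    blocksNonEmpty (Vec.map relabel (merge s xs ys)) ≡ (0 <ᵇ a) ∧ blocksNonEmpty ys
  blocksNonEmpty-merge {k = k} s xs ys =
    cong₂ _∧_ (occurs-zero s xs ys) (foldr-∧-tabulate-cong k (λ j → occurs-suc j s xs ys))

  ArrBlocks : ℕ → ℕ → Set
  ArrBlocks k n = Σ (Assignment β γ k n) (T ∘ blocksNonEmpty)

  FirstBlock : ℕ → Set
  FirstBlock a = T (0 <ᵇ a) × Vec (Fin β) a

  ArrBlocks-zero↔ : ArrBlocks 0 n ↔ Fin (γ ^ n)
  ArrBlocks-zero↔ {n} = ↔-trans (mk↔ₛ′ proj₁ (_, tt) (λ _ → refl) (λ _ → refl))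
                    (↔-trans (Vec-map-↔ Label-zero↔) (Vec-Fin↔Fin^ γ n))

  -- Block zero is the first block of the right section: its elements are the left items of the
  -- shuffle, and the other elements form an assignment into the remaining k blocks.
  ArrBlocks-suc↔ : ArrBlocks (suc k) n ↔ Shuffled n (λ a b → FirstBlock a × ArrBlocks k b)
  ArrBlocks-suc↔ {k} {n} = ↔-trans
    (Σ-T-↔ (↔-trans (Vec-map-↔ Label-suc↔) Vec-⊎↔Shuffled)
           (λ (_ , _ , s , xs , ys) → blocksNonEmpty-merge s xs ys))
    (mk↔ₛ′ to from to∘from from∘to)
    where
    nonEmpty : Shuffled n Vecs → Bool
    nonEmpty (a , _ , _ , _ , ys) = (0 <ᵇ a) ∧ blocksNonEmpty ys
    to : Σ (Shuffled n Vecs) (T ∘ nonEmpty) → Shuffled n (λ a b → FirstBlock a × ArrBlocks k b)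
    to ((a , b , s , xs , ys) , t) =
      let t₁ , t₂ = Equivalence.to T-∧ t in a , b , s , (t₁ , xs) , ys , t₂
    from : Shuffled n (λ a b → FirstBlock a × ArrBlocks k b) → Σ (Shuffled n Vecs) (T ∘ nonEmpty)
    from (a , b , s , (t , xs) , ys , t′) = (a , b , s , xs , ys) , Equivalence.from T-∧ (t , t′)
    to∘from : ∀ y → to (from y) ≡ y
    to∘from (a , b , s , (t , xs) , ys , t′) =
      cong₂ (λ t t′ → a , b , s , (t , xs) , ys , t′) (T-irrelevant _ _) (T-irrelevant _ _)
    from∘to : ∀ x → from (to x) ≡ x
    from∘to (S , t) = cong (S ,_) (T-irrelevant _ _)

  Arr↔ : Arr β γ n ↔ (Fin (γ ^ n) ⊎ Shuffled n (λ a b → FirstBlock a × Arr β γ b))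
  Arr↔ {n} = ↔-trans (Σℕ↔⊎ (λ k → ArrBlocks k n))
    (ArrBlocks-zero↔ ⊎-↔ ↔-trans (Σ-↔ ↔-refl ArrBlocks-suc↔) (Σ-Shuffled-comm n FirstBlock ArrBlocks))

  firstBlockCount : ℕ → ℕ
  firstBlockCount zero    = 0
  firstBlockCount (suc a) = β ^ suc a

  -- Tabulating arrCount (n ∸ k) for every k makes the course-of-values recursion structural.
  arrCount∸ : ℕ → ℕ → ℕ
  arrCount∸ zero    _       = 1
  arrCount∸ (suc n) zero    = γ ^ suc n + sumToℕ n (λ k → (suc n C suc k) * (β ^ suc k * arrCount∸ n k))
  arrCount∸ (suc n) (suc k) = arrCount∸ n k

  arrCount : ℕ → ℕ
  arrCount n = arrCount∸ n 0

  arrCount∸≡arrCount : ∀ n k → arrCount∸ n k ≡ arrCount (n ∸ k)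
  arrCount∸≡arrCount zero    zero    = refl
  arrCount∸≡arrCount zero    (suc k) = refl
  arrCount∸≡arrCount (suc n) zero    = refl
  arrCount∸≡arrCount (suc n) (suc k) = arrCount∸≡arrCount n k

  arrCount-suc : ∀ n → arrCount (suc n) ≡
                 γ ^ suc n + sumToℕ n (λ k → (suc n C suc k) * (β ^ suc k * arrCount (n ∸ k)))
  arrCount-suc n = cong (γ ^ suc n +_)
    (sumToℕ-cong n (λ k _ → cong (λ c → (suc n C suc k) * (β ^ suc k * c)) (arrCount∸≡arrCount n k)))

  arrCount-shuffleCount : ∀ n → arrCount n ≡ γ ^ n + shuffleCount n (λ a b → firstBlockCount a * arrCount b)
  arrCount-shuffleCount zero    = refl
  arrCount-shuffleCount (suc n) = trans (arrCount-suc n) (cong (γ ^ suc n +_) (sym (begin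
    shuffleCount (suc n) p                                 ≡⟨ shuffleCount-binomial (suc n) p ⟩
    sumToℕ (suc n) (λ a → (suc n C a) * p a (suc n ∸ a))   ≡⟨ sumToℕ-suc n _ ⟩
    (suc n C 0) * 0 + later                                ≡⟨ cong (_+ later) (*-zeroʳ (suc n C 0)) ⟩
    later                                                  ∎)))
    where
    open ≡-Reasoning
    p : ℕ → ℕ → ℕ
    p a b = firstBlockCount a * arrCount b
    later : ℕ
    later = sumToℕ n (λ k → (suc n C suc k) * (β ^ suc k * arrCount (n ∸ k)))

  Arr↔Fin : ∀ n → Arr β γ n ↔ Fin (arrCount n)
  Arr↔Fin = <-rec _ λ n Arr<n↔Fin → ↔-trans Arr↔ (↔-trans
    (↔-refl ⊎-↔ Shuffled↔Fin n _ _ (parts n Arr<n↔Fin))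
    (↔-trans (↔-sym +↔⊎) (K-reflexive (cong Fin (sym (arrCount-shuffleCount n))))))
    where
    parts : ∀ n → (∀ {b} → b < n → Arr β γ b ↔ Fin (arrCount b)) →
            ∀ a b → a + b ≡ n → (FirstBlock a × Arr β γ b) ↔ Fin (firstBlockCount a * arrCount b)
    parts n Arr<n↔Fin zero    b _   = mk↔ₛ′ (λ { ((() , _) , _) }) (λ ()) (λ ()) (λ { ((() , _) , _) })
    parts n Arr<n↔Fin (suc a) b a+b≡n = ↔-trans
      (↔-trans (mk↔ₛ′ proj₂ (tt ,_) (λ _ → refl) (λ _ → refl)) (Vec-Fin↔Fin^ β (suc a)) ×-↔
       Arr<n↔Fin (subst (b <_) a+b≡n (s≤s (m≤n+m b a))))
      (↔-sym *↔×)

module _ (β γ : ℕ) (H : EGF) (H-eq : ∀ n → egfMul (twoMinusExp β) H n ≡ expS γ n) where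
  open +-*-Solver

  constant-term : ∀ h → ℕ→ℚ 1 ℚ.* ((ℕ→ℚ 2 ℚ.- ℕ→ℚ 1) ℚ.* h) ≡ h
  constant-term = solve 1 (λ h → con (ℕ→ℚ 1) :* ((con (ℕ→ℚ 2) :- con (ℕ→ℚ 1)) :* h) := h) refl

  H-zero : H 0 ≡ ℕ→ℚ 1
  H-zero = trans (sym (constant-term (H 0))) (H-eq 0)

  H-suc : ∀ n → H (suc n) ≡
          ℕ→ℚ (γ ^ suc n) ℚ.+ sumTo n (λ k → ℕ→ℚ (suc n C suc k) ℚ.* (ℕ→ℚ (β ^ suc k) ℚ.* H (n ∸ k)))
  H-suc n = begin
    H (suc n)                  ≡⟨ solve 2 (λ h s → h := h :+ :- s :+ s) refl (H (suc n)) S ⟩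
    H (suc n) ℚ.+ - S ℚ.+ S    ≡⟨ cong (ℚ._+ S) H-eq′ ⟩
    ℕ→ℚ (γ ^ suc n) ℚ.+ S      ∎
    where
    open ≡-Reasoning
    egfTerm term : ℕ → ℚ
    egfTerm k = ℕ→ℚ (suc n C k) ℚ.* (twoMinusExp β k ℚ.* H (suc n ∸ k))
    term    k = ℕ→ℚ (suc n C suc k) ℚ.* (ℕ→ℚ (β ^ suc k) ℚ.* H (n ∸ k))
    S : ℚ
    S = sumTo n term
    negated-term : ∀ k → k ≤ n → egfTerm (suc k) ≡ - term k
    negated-term k _ = solve 3 (λ c b h → c :* ((con 0ℚ :- b) :* h) := :- (c :* (b :* h))) refl
                               (ℕ→ℚ (suc n C suc k)) (ℕ→ℚ (β ^ suc k)) (H (n ∸ k))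
    H-eq′ : H (suc n) ℚ.+ - S ≡ ℕ→ℚ (γ ^ suc n)
    H-eq′ = begin
      H (suc n) ℚ.+ - S                         ≡⟨ cong₂ ℚ._+_ (constant-term (H (suc n))) (sumTo-neg n term) ⟨
      egfTerm 0 ℚ.+ sumTo n (λ k → - term k)    ≡⟨ cong (egfTerm 0 ℚ.+_) (sumTo-cong n negated-term) ⟨
      egfTerm 0 ℚ.+ sumTo n (egfTerm ∘ suc)     ≡⟨ sumTo-suc n egfTerm ⟨
      egfMul (twoMinusExp β) H (suc n)          ≡⟨ H-eq (suc n) ⟩
      ℕ→ℚ (γ ^ suc n)                           ∎

  H≡arrCount : ∀ n → H n ≡ ℕ→ℚ (arrCount β γ n)
  H≡arrCount = <-rec _ step
    where
    step : ∀ n → (∀ {b} → b < n → H b ≡ ℕ→ℚ (arrCount β γ b)) → H n ≡ ℕ→ℚ (arrCount β γ n)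
    step zero    _    = H-zero
    step (suc n) H<n≡ = begin
      H (suc n)
        ≡⟨ H-suc n ⟩
      ℕ→ℚ (γ ^ suc n) ℚ.+ sumTo n (λ k → ℕ→ℚ (suc n C suc k) ℚ.* (ℕ→ℚ (β ^ suc k) ℚ.* H (n ∸ k)))
        ≡⟨ cong (ℕ→ℚ (γ ^ suc n) ℚ.+_) (sumTo-cong n (λ k _ → term≡ k (H<n≡ (s≤s (m∸n≤m n k))))) ⟩
      ℕ→ℚ (γ ^ suc n) ℚ.+ sumTo n (ℕ→ℚ ∘ term)
        ≡⟨ cong (ℕ→ℚ (γ ^ suc n) ℚ.+_) (ℕ→ℚ-sumTo n term) ⟨
      ℕ→ℚ (γ ^ suc n) ℚ.+ ℕ→ℚ (sumToℕ n term)
        ≡⟨ ℕ→ℚ-+ (γ ^ suc n) (sumToℕ n term) ⟨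
      ℕ→ℚ (γ ^ suc n + sumToℕ n term)
        ≡⟨ cong ℕ→ℚ (arrCount-suc β γ n) ⟨
      ℕ→ℚ (arrCount β γ (suc n)) ∎
      where
      open ≡-Reasoning
      term : ℕ → ℕ
      term k = (suc n C suc k) * (β ^ suc k * arrCount β γ (n ∸ k))
      term≡ : ∀ k → H (n ∸ k) ≡ ℕ→ℚ (arrCount β γ (n ∸ k)) →
              ℕ→ℚ (suc n C suc k) ℚ.* (ℕ→ℚ (β ^ suc k) ℚ.* H (n ∸ k)) ≡ ℕ→ℚ (term k)
      term≡ k H≡ = begin
        ℕ→ℚ (suc n C suc k) ℚ.* (ℕ→ℚ (β ^ suc k) ℚ.* H (n ∸ k))
          ≡⟨ cong (λ h → ℕ→ℚ (suc n C suc k) ℚ.* (ℕ→ℚ (β ^ suc k) ℚ.* h)) H≡ ⟩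
        ℕ→ℚ (suc n C suc k) ℚ.* (ℕ→ℚ (β ^ suc k) ℚ.* ℕ→ℚ (arrCount β γ (n ∸ k)))
          ≡⟨ cong (ℕ→ℚ (suc n C suc k) ℚ.*_) (ℕ→ℚ-* (β ^ suc k) (arrCount β γ (n ∸ k))) ⟨
        ℕ→ℚ (suc n C suc k) ℚ.* ℕ→ℚ (β ^ suc k * arrCount β γ (n ∸ k))
          ≡⟨ ℕ→ℚ-* (suc n C suc k) _ ⟨
        ℕ→ℚ (term k) ∎

theorem2 : (β γ : ℕ) → ¬ (β ≡ 0 × γ ≡ 0) →
           -- H is the series e^{γx} / (2 - e^{βx}) (coefficients of x^n/n!)
           (H : EGF) → (∀ n → egfMul (twoMinusExp β) H n ≡ expS γ n) →
           -- H_n equals the number m of arrangements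
           (n m : ℕ) → (Arr β γ n ↔ Fin m) → H n ≡ ℕ→ℚ m
theorem2 β γ _ H H-eq n m Arr↔Fin-m = begin
  H n                      ≡⟨ H≡arrCount β γ H H-eq n ⟩
  ℕ→ℚ (arrCount β γ n)     ≡⟨ cong ℕ→ℚ (Fin-injective (↔-trans (↔-sym (Arr↔Fin β γ n)) Arr↔Fin-m)) ⟩
  ℕ→ℚ m                    ∎
  where open ≡-Reasoning
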